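{- Let $r\geq 2$, $n\geq 2r+1$ and $k\geq 2$ be integers. Then $\gamma_{\times k}(K(n,r))=k+r$ if and only if $n\geq r(k+r)$.
   Context: The Kneser graph $K(n,r)$ has as vertices the $r$-subsets of $[n]=\{1,\dots,n\}$, two vertices adjacent iff disjoint. For a vertex $v$, $N[v]$ is its closed neighbourhood. A set $D$ of vertices is a $k$-tuple dominating set if $|N[v]\cap D|\geq k$ for every vertex $v$; $\gamma_{\times k}(K(n,r))$ is the minimum cardinality of such a set (defined when $k\leq \binom{n-r}{r}+1$). -}

module Defs where

open import Data.Nat using (ℕ; _≤_; _+_; _∸_)
open import Data.Bool using (Bool)
open import Data.Bool.Properties using () renaming (_≟_ to _≟ᵇ_)
open import Data.Fin.Subset using (Subset; _∩_; ⊥; ∣_∣)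
open import Data.Vec.Properties using (≡-dec)
open import Data.List using (List; length; filter)
open import Data.List.Relation.Unary.All using (All)
open import Data.List.Relation.Unary.Unique.Propositional using (Unique)
open import Data.Product using (Σ; _×_)
open import Data.Sum using (_⊎_)
open import Relation.Nullary using (Dec)
open import Relation.Nullary.Decidable using (_⊎-dec_)
open import Relation.Binary.PropositionalEquality using (_≡_)

-- Vertices of the Kneser graph K(n,r): subsets of [n] (= Fin n) of size r.
IsVertex : (n r : ℕ) → Subset n → Set
IsVertex n r s = ∣ s ∣ ≡ r

-- Adjacency in K(n,r): disjointness.
Disjoint : {n : ℕ} → Subset n → Subset n → Set
Disjoint s t = s ∩ t ≡ ⊥

_≟ₛ_ : {n : ℕ} → (s t : Subset n) → Dec (s ≡ t)
_≟ₛ_ = ≡-dec _≟ᵇ_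

-- u ∈ N[v]  (closed neighbourhood: u = v or u adjacent to v)
InClosedNbhd : {n : ℕ} → Subset n → Subset n → Set
InClosedNbhd v u = (u ≡ v) ⊎ Disjoint u v

inClosedNbhd? : {n : ℕ} → (v u : Subset n) → Dec (InClosedNbhd v u)
inClosedNbhd? v u = (u ≟ₛ v) ⊎-dec ((u ∩ v) ≟ₛ ⊥)

nbhdCount : {n : ℕ} → Subset n → List (Subset n) → ℕ
nbhdCount v D = length (filter (inClosedNbhd? v) D)

IsKTupleDominating : (n r k : ℕ) → List (Subset n) → Set
IsKTupleDominating n r k D =
  Unique D × All (IsVertex n r) D ×
  ((v : Subset n) → IsVertex n r v → k ≤ nbhdCount v D)

GammaTimesIs : (n r k m : ℕ) → Set
GammaTimesIs n r k m =
  Σ (List (Subset n)) (λ D → IsKTupleDominating n r k D × length D ≡ m)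
  × ((D : List (Subset n)) → IsKTupleDominating n r k D → m ≤ length D)

-- Any r members of a k-tuple dominating set D of K(n,r) can be escaped: some r-set v
-- meets all of them and equals none, so they lie outside N[v] and |D| ≥ k + r.
-- Conversely k + r pairwise disjoint r-sets form a k-tuple dominating set, since an
-- r-set meets at most r of them, and they fit into [n] iff r(k + r) ≤ n.  It remains
-- that a k-tuple dominating set of size k + r is pairwise disjoint: if two members a, b
-- meet in x, some r-set through x has at most one of the first r + 2 members in its
-- closed neighbourhood, which leaves it only k − 1 members of D.
module Submission where

open import Defs
open import Data.Nat using (ℕ; _≤_; _+_; _*_; _∸_; suc)
open import Data.Nat.Combinatorics using (_C_)
open import Data.Product using (_×_)

open import Data.Nat using (zero; _<_; _≤?_; z≤n; s≤s)
open import Data.Nat.Properties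
open import Data.Fin using (Fin; zero; suc) renaming (_≟_ to _≟ᶠ_)
open import Data.Fin.Properties using (any?)
open import Data.Fin.Subset
  using (Subset; _∈_; _∉_; _⊆_; _∩_; _∪_; _─_; _-_; ⊥; ∁; ⁅_⁆; ⋃; ∣_∣; Nonempty; inside; outside)
open import Data.Fin.Subset.Properties
  using ( Empty-unique; nonempty?; _∈?_; ∉⊥; x∈p∩q⁺; x∈p∩q⁻; x∈p∪q⁺; x∈p∪q⁻; x∈⁅x⁆; x∈⁅y⁆⇒x≡y
        ; x∉⁅y⁆⇒x≢y; x∈p∧x≢y⇒x∈p-y; x∈∁p⇒x∉p; x∉∁p⇒x∈p; p⊆p∪q; q⊆p∪q; p─q⊆p; s⊆s; out⊆
        ; p⊆q⇒∣p∣≤∣q∣; ∣p∣≤n; ∣p∣≤∣p∪q∣; ∣q∣≤∣p∪q∣; ∣p∩q∣≤∣p∣; ∣⁅x⁆∣≡1; ∣⊥∣≡0; ∣∁p∣≡n∸∣p∣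
        ; ∩-zeroʳ; ∩-distribˡ-∪)
open import Data.Vec using ([]; _∷_; tail; there)
open import Data.List using (List; []; _∷_; length; filter; take; drop; _++_)
open import Data.List.Properties
  using (filter-none; filter-accept; filter-reject; filter-++; length-++; length-filter; length-take; length-drop; take++drop≡id)
open import Data.List.Relation.Unary.All as All using (All; []; _∷_)
import Data.List.Relation.Unary.All.Properties as All
open import Data.List.Relation.Unary.AllPairs using (AllPairs; []; _∷_)
open import Data.List.Relation.Unary.Unique.Propositional using (Unique)
import Data.List.Relation.Unary.Unique.Propositional.Properties as Unique
open import Data.List.Relation.Binary.Permutation.Propositional
  using (_↭_; ↭-refl; ↭-prep; ↭-swap; ↭-trans; ↭⇒↭ₛ)
open import Data.List.Relation.Binary.Permutation.Propositional.Properties using (All-resp-↭; ↭-length; filter-↭)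
import Data.List.Relation.Binary.Permutation.Setoid.Properties as ↭ₛ
open import Data.Product using (Σ; _,_; proj₂)
open import Data.Sum using (_⊎_; inj₁; inj₂; [_,_]′)
open import Data.Empty using (⊥-elim)
open import Relation.Nullary using (¬_; Dec; yes; no; contradiction)
open import Relation.Nullary.Decidable using (_×-dec_)
open import Relation.Binary.PropositionalEquality
  using (_≡_; _≢_; refl; sym; trans; cong; cong₂; subst; setoid; module ≡-Reasoning)

private
  variable
    n : ℕ

Meets : Subset n → Subset n → Set
Meets {n} p q = Σ (Fin n) λ x → x ∈ p × x ∈ q

disjoint? : (p q : Subset n) → Dec (Disjoint p q)
disjoint? p q = (p ∩ q) ≟ₛ ⊥

Meets⇒¬Disjoint : {p q : Subset n} → Meets p q → ¬ Disjoint p q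
Meets⇒¬Disjoint (x , x∈p , x∈q) p∩q≡⊥ = ∉⊥ (subst (x ∈_) p∩q≡⊥ (x∈p∩q⁺ (x∈p , x∈q)))

¬Meets⇒Disjoint : {p q : Subset n} → ¬ Meets p q → Disjoint p q
¬Meets⇒Disjoint {p = p} {q} ¬meets = Empty-unique λ (x , x∈p∩q) → ¬meets (x , x∈p∩q⁻ p q x∈p∩q)

¬Disjoint⇒Meets : {p q : Subset n} → ¬ Disjoint p q → Meets p q
¬Disjoint⇒Meets {p = p} {q} ¬disjoint with nonempty? (p ∩ q)
... | yes (x , x∈p∩q) = x , x∈p∩q⁻ p q x∈p∩q
... | no empty        = contradiction (Empty-unique empty) ¬disjoint

Disjoint⇒∉ˡ : {p q : Subset n} {x : Fin n} → Disjoint p q → x ∈ q → x ∉ p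
Disjoint⇒∉ˡ p⊥q x∈q x∈p = Meets⇒¬Disjoint (_ , x∈p , x∈q) p⊥q

Disjoint⇒∉ʳ : {p q : Subset n} {x : Fin n} → Disjoint p q → x ∈ p → x ∉ q
Disjoint⇒∉ʳ p⊥q x∈p x∈q = Disjoint⇒∉ˡ p⊥q x∈q x∈p

Meets-⊆ʳ : {p q q′ : Subset n} → q ⊆ q′ → Meets p q → Meets p q′
Meets-⊆ʳ q⊆q′ (x , x∈p , x∈q) = x , x∈p , q⊆q′ x∈q

Disjoint-⊆ʳ : {p q q′ : Subset n} → q ⊆ q′ → Disjoint p q′ → Disjoint p q
Disjoint-⊆ʳ q⊆q′ p⊥q′ = ¬Meets⇒Disjoint λ meets → Meets⇒¬Disjoint (Meets-⊆ʳ q⊆q′ meets) p⊥q′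

Disjoint-⋃⁺ : {d : Subset n} (D : List (Subset n)) → All (Disjoint d) D → Disjoint d (⋃ D)
Disjoint-⋃⁺ [] [] = ∩-zeroʳ _
Disjoint-⋃⁺ (e ∷ D) (d⊥e ∷ d⊥D) = ¬Meets⇒Disjoint λ (x , x∈d , x∈e∪⋃D) →
  [ (λ x∈e → Meets⇒¬Disjoint (x , x∈d , x∈e) d⊥e)
  , (λ x∈⋃D → Meets⇒¬Disjoint (x , x∈d , x∈⋃D) (Disjoint-⋃⁺ D d⊥D))
  ]′ (x∈p∪q⁻ e (⋃ D) x∈e∪⋃D)

Disjoint-⋃⁻ : {d : Subset n} (D : List (Subset n)) → Disjoint d (⋃ D) → All (Disjoint d) D
Disjoint-⋃⁻ [] _ = []
Disjoint-⋃⁻ (e ∷ D) d⊥e∪⋃D =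
  Disjoint-⊆ʳ (p⊆p∪q (⋃ D)) d⊥e∪⋃D ∷ Disjoint-⋃⁻ D (Disjoint-⊆ʳ (q⊆p∪q e (⋃ D)) d⊥e∪⋃D)

∣p∪q∣≤∣p∣+∣q∣ : (p q : Subset n) → ∣ p ∪ q ∣ ≤ ∣ p ∣ + ∣ q ∣
∣p∪q∣≤∣p∣+∣q∣ [] [] = z≤n
∣p∪q∣≤∣p∣+∣q∣ (inside ∷ p) (inside ∷ q) = s≤s (≤-trans (∣p∪q∣≤∣p∣+∣q∣ p q) (+-monoʳ-≤ ∣ p ∣ (n≤1+n ∣ q ∣)))
∣p∪q∣≤∣p∣+∣q∣ (inside ∷ p) (outside ∷ q) = s≤s (∣p∪q∣≤∣p∣+∣q∣ p q)
∣p∪q∣≤∣p∣+∣q∣ (outside ∷ p) (inside ∷ q) = subst (suc ∣ p ∪ q ∣ ≤_) (sym (+-suc ∣ p ∣ ∣ q ∣)) (s≤s (∣p∪q∣≤∣p∣+∣q∣ p q))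
∣p∪q∣≤∣p∣+∣q∣ (outside ∷ p) (outside ∷ q) = ∣p∪q∣≤∣p∣+∣q∣ p q

∣p∪q∣≡∣p∣+∣q∣ : (p q : Subset n) → Disjoint p q → ∣ p ∪ q ∣ ≡ ∣ p ∣ + ∣ q ∣
∣p∪q∣≡∣p∣+∣q∣ [] [] _ = refl
∣p∪q∣≡∣p∣+∣q∣ (inside ∷ p) (inside ∷ q) ()
∣p∪q∣≡∣p∣+∣q∣ (inside ∷ p) (outside ∷ q) p⊥q = cong suc (∣p∪q∣≡∣p∣+∣q∣ p q (cong tail p⊥q))
∣p∪q∣≡∣p∣+∣q∣ (outside ∷ p) (inside ∷ q) p⊥q =
  trans (cong suc (∣p∪q∣≡∣p∣+∣q∣ p q (cong tail p⊥q))) (sym (+-suc ∣ p ∣ ∣ q ∣))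
∣p∪q∣≡∣p∣+∣q∣ (outside ∷ p) (outside ∷ q) p⊥q = ∣p∪q∣≡∣p∣+∣q∣ p q (cong tail p⊥q)

∣p∪⁅x⁆∣≤1+∣p∣ : (p : Subset n) (x : Fin n) → ∣ p ∪ ⁅ x ⁆ ∣ ≤ suc ∣ p ∣
∣p∪⁅x⁆∣≤1+∣p∣ p x = begin
  ∣ p ∪ ⁅ x ⁆ ∣       ≤⟨ ∣p∪q∣≤∣p∣+∣q∣ p ⁅ x ⁆ ⟩
  ∣ p ∣ + ∣ ⁅ x ⁆ ∣   ≡⟨ cong (∣ p ∣ +_) (∣⁅x⁆∣≡1 x) ⟩
  ∣ p ∣ + 1           ≡⟨ +-comm ∣ p ∣ 1 ⟩
  suc ∣ p ∣           ∎
  where open ≤-Reasoning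

∣p∪⁅x⁆∣≡1+∣p∣ : (p : Subset n) {x : Fin n} → x ∉ p → ∣ p ∪ ⁅ x ⁆ ∣ ≡ suc ∣ p ∣
∣p∪⁅x⁆∣≡1+∣p∣ p {x} x∉p = begin
  ∣ p ∪ ⁅ x ⁆ ∣       ≡⟨ ∣p∪q∣≡∣p∣+∣q∣ p ⁅ x ⁆ p⊥⁅x⁆ ⟩
  ∣ p ∣ + ∣ ⁅ x ⁆ ∣   ≡⟨ cong (∣ p ∣ +_) (∣⁅x⁆∣≡1 x) ⟩
  ∣ p ∣ + 1           ≡⟨ +-comm ∣ p ∣ 1 ⟩
  suc ∣ p ∣           ∎
  where
  open ≡-Reasoning
  p⊥⁅x⁆ : Disjoint p ⁅ x ⁆
  p⊥⁅x⁆ = ¬Meets⇒Disjoint λ (y , y∈p , y∈⁅x⁆) → x∉p (subst (_∈ p) (x∈⁅y⁆⇒x≡y x y∈⁅x⁆) y∈p)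

∣p∣≤1+∣p-x∣ : (p : Subset n) (x : Fin n) → ∣ p ∣ ≤ suc ∣ p - x ∣
∣p∣≤1+∣p-x∣ p x = ≤-trans (p⊆q⇒∣p∣≤∣q∣ p⊆[p-x]∪⁅x⁆) (∣p∪⁅x⁆∣≤1+∣p∣ (p - x) x)
  where
  p⊆[p-x]∪⁅x⁆ : p ⊆ (p - x) ∪ ⁅ x ⁆
  p⊆[p-x]∪⁅x⁆ {y} y∈p with y ≟ᶠ x
  ... | yes refl = x∈p∪q⁺ (inj₂ (x∈⁅x⁆ y))
  ... | no y≢x   = x∈p∪q⁺ (inj₁ (x∈p∧x≢y⇒x∈p-y y∈p y≢x))

x∈p─q⇒x∉q : (p q : Subset n) {x : Fin n} → x ∈ p ─ q → x ∉ q
x∈p─q⇒x∉q (_ ∷ p) (_ ∷ q) (there x∈p─q) (there x∈q) = x∈p─q⇒x∉q p q x∈p─q x∈q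
x∈p─q⇒x∉q (_ ∷ p) (inside ∷ q) {zero} ()

0<∣p∣⇒Nonempty : (p : Subset n) → 0 < ∣ p ∣ → Nonempty p
0<∣p∣⇒Nonempty {n} p 0<∣p∣ with nonempty? p
... | yes p≢∅ = p≢∅
... | no p≡∅  = contradiction (trans (cong ∣_∣ (Empty-unique p≡∅)) (∣⊥∣≡0 n)) (>⇒≢ 0<∣p∣)

∣p∣≡r⇒Nonempty : {p : Subset n} {r : ℕ} → 0 < r → ∣ p ∣ ≡ r → Nonempty p
∣p∣≡r⇒Nonempty {p = p} 0<r ∣p∣≡r = 0<∣p∣⇒Nonempty p (subst (0 <_) (sym ∣p∣≡r) 0<r)

x∈p⇒1≤∣p∣ : {p : Subset n} {x : Fin n} → x ∈ p → 1 ≤ ∣ p ∣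
x∈p⇒1≤∣p∣ {p = p} {x} x∈p =
  subst (_≤ ∣ p ∣) (∣⁅x⁆∣≡1 x) (p⊆q⇒∣p∣≤∣q∣ λ y∈⁅x⁆ → subst (_∈ p) (sym (x∈⁅y⁆⇒x≡y x y∈⁅x⁆)) x∈p)

∣p∣≡∣q∣⇒∣p∪q∣≡∣p∣⇒p≡q : (p q : Subset n) → ∣ p ∣ ≡ ∣ q ∣ → ∣ p ∪ q ∣ ≡ ∣ p ∣ → p ≡ q
∣p∣≡∣q∣⇒∣p∪q∣≡∣p∣⇒p≡q [] [] _ _ = refl
∣p∣≡∣q∣⇒∣p∪q∣≡∣p∣⇒p≡q (inside ∷ p) (inside ∷ q) e₁ e₂ =
  cong (inside ∷_) (∣p∣≡∣q∣⇒∣p∪q∣≡∣p∣⇒p≡q p q (suc-injective e₁) (suc-injective e₂))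
∣p∣≡∣q∣⇒∣p∪q∣≡∣p∣⇒p≡q (outside ∷ p) (outside ∷ q) e₁ e₂ = cong (outside ∷_) (∣p∣≡∣q∣⇒∣p∪q∣≡∣p∣⇒p≡q p q e₁ e₂)
∣p∣≡∣q∣⇒∣p∪q∣≡∣p∣⇒p≡q (inside ∷ p) (outside ∷ q) e₁ e₂ =
  contradiction (≤-trans (≤-reflexive e₁) (≤-trans (∣q∣≤∣p∪q∣ p q) (≤-reflexive (suc-injective e₂)))) (<-irrefl refl)
∣p∣≡∣q∣⇒∣p∪q∣≡∣p∣⇒p≡q (outside ∷ p) (inside ∷ q) e₁ e₂ =
  contradiction (≤-trans (≤-reflexive e₂) (∣p∣≤∣p∪q∣ p q)) (<-irrefl refl)

∣p∣<∣p∪q∣ : (p q : Subset n) → ∣ p ∣ ≡ ∣ q ∣ → p ≢ q → ∣ p ∣ < ∣ p ∪ q ∣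
∣p∣<∣p∪q∣ p q ∣p∣≡∣q∣ p≢q =
  ≤∧≢⇒< (∣p∣≤∣p∪q∣ p q) λ ∣p∣≡∣p∪q∣ → p≢q (∣p∣≡∣q∣⇒∣p∪q∣≡∣p∣⇒p≡q p q ∣p∣≡∣q∣ (sym ∣p∣≡∣p∪q∣))

∣⋃∣≡length*r : {r : ℕ} (D : List (Subset n)) → AllPairs Disjoint D → All (λ e → ∣ e ∣ ≡ r) D
             → ∣ ⋃ D ∣ ≡ length D * r
∣⋃∣≡length*r {n} [] _ _ = ∣⊥∣≡0 n
∣⋃∣≡length*r (d ∷ D) (d⊥D ∷ pairwise) (∣d∣ ∷ sizes) =
  trans (∣p∪q∣≡∣p∣+∣q∣ d (⋃ D) (Disjoint-⋃⁺ D d⊥D)) (cong₂ _+_ ∣d∣ (∣⋃∣≡length*r D pairwise sizes))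

∪⁅⁆-injective : (p : Subset n) {x y : Fin n} → x ∉ p → p ∪ ⁅ x ⁆ ≡ p ∪ ⁅ y ⁆ → x ≡ y
∪⁅⁆-injective p {x} {y} x∉p eq =
  [ (λ x∈p → contradiction x∈p x∉p) , x∈⁅y⁆⇒x≡y y ]′
    (x∈p∪q⁻ p ⁅ y ⁆ (subst (x ∈_) eq (x∈p∪q⁺ (inj₂ (x∈⁅x⁆ x)))))

superset-of-size : (X : Subset n) (m : ℕ) → ∣ X ∣ ≤ m → m ≤ n → Σ (Subset n) λ v → X ⊆ v × ∣ v ∣ ≡ m
superset-of-size [] zero _ _ = [] , (λ x∈X → x∈X) , refl
superset-of-size (inside ∷ X) (suc m) (s≤s ∣X∣≤m) (s≤s m≤n) with superset-of-size X m ∣X∣≤m m≤n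
... | v , X⊆v , ∣v∣≡m = inside ∷ v , s⊆s X⊆v , cong suc ∣v∣≡m
superset-of-size {suc n} (outside ∷ X) m ∣X∣≤m m≤1+n with m ≤? n
... | yes m≤n with superset-of-size X m ∣X∣≤m m≤n
...   | v , X⊆v , ∣v∣≡m = outside ∷ v , s⊆s X⊆v , ∣v∣≡m
superset-of-size {suc n} (outside ∷ X) m ∣X∣≤m m≤1+n | no m≰n with superset-of-size X n (∣p∣≤n X) ≤-refl
...   | v , X⊆v , ∣v∣≡n = inside ∷ v , out⊆ X⊆v , trans (cong suc ∣v∣≡n) (≤-antisym (≰⇒> m≰n) m≤1+n)

subset-of-size : (S : Subset n) (m : ℕ) → m ≤ ∣ S ∣ → Σ (Subset n) λ e → e ⊆ S × ∣ e ∣ ≡ m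
subset-of-size {n} S m m≤∣S∣ with superset-of-size (∁ S) (n ∸ m) ∣∁S∣≤n∸m (m∸n≤m n m)
  where
  ∣∁S∣≤n∸m : ∣ ∁ S ∣ ≤ n ∸ m
  ∣∁S∣≤n∸m = subst (_≤ n ∸ m) (sym (∣∁p∣≡n∸∣p∣ S)) (∸-monoʳ-≤ n m≤∣S∣)
... | T , ∁S⊆T , ∣T∣≡n∸m = ∁ T , ∁T⊆S , ∣∁T∣≡m
  where
  ∁T⊆S : ∁ T ⊆ S
  ∁T⊆S x∈∁T = x∉∁p⇒x∈p λ x∈∁S → x∈∁p⇒x∉p x∈∁T (∁S⊆T x∈∁S)
  ∣∁T∣≡m : ∣ ∁ T ∣ ≡ m
  ∣∁T∣≡m = trans (∣∁p∣≡n∸∣p∣ T) (trans (cong (n ∸_) ∣T∣≡n∸m) (m∸[m∸n]≡n (≤-trans m≤∣S∣ (∣p∣≤n S))))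

point-avoiding : (Y S : Subset n) → (∀ {z} → z ∈ S → z ∉ Y) → (F : List (Subset n)) → length F < ∣ S ∣
               → Σ (Fin n) λ z → z ∈ S × All (_≢ Y ∪ ⁅ z ⁆) F
point-avoiding Y S S⊥Y [] 0<∣S∣ with 0<∣p∣⇒Nonempty S 0<∣S∣
... | z , z∈S = z , z∈S , []
point-avoiding Y S S⊥Y (f ∷ F) ∣F∣<∣S∣ with any? (λ z → (z ∈? S) ×-dec ((Y ∪ ⁅ z ⁆) ≟ₛ f))
... | no ¬hit with point-avoiding Y S S⊥Y F (≤-trans (n≤1+n _) ∣F∣<∣S∣)
...   | z , z∈S , avoids = z , z∈S , (λ f≡Y∪⁅z⁆ → ¬hit (z , z∈S , sym f≡Y∪⁅z⁆)) ∷ avoids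
point-avoiding Y S S⊥Y (f ∷ F) ∣F∣<∣S∣ | yes (z₀ , z₀∈S , Y∪⁅z₀⁆≡f)
  with point-avoiding Y (S - z₀) (λ z∈S-z₀ → S⊥Y (p─q⊆p S ⁅ z₀ ⁆ z∈S-z₀)) F
         (≤-pred (≤-trans ∣F∣<∣S∣ (∣p∣≤1+∣p-x∣ S z₀)))
... | z , z∈S-z₀ , avoids = z , p─q⊆p S ⁅ z₀ ⁆ z∈S-z₀ , f≢Y∪⁅z⁆ ∷ avoids
  where
  f≢Y∪⁅z⁆ : f ≢ Y ∪ ⁅ z ⁆
  f≢Y∪⁅z⁆ f≡Y∪⁅z⁆ = x∉⁅y⁆⇒x≢y (x∈p─q⇒x∉q S ⁅ z₀ ⁆ z∈S-z₀)
    (sym (∪⁅⁆-injective Y (S⊥Y z₀∈S) (trans Y∪⁅z₀⁆≡f f≡Y∪⁅z⁆)))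

superset-avoiding : (W : Subset n) (m : ℕ) → ∣ W ∣ ≤ m → (F : List (Subset n)) → length F + m < n
                  → Σ (Subset n) λ v → W ⊆ v × ∣ v ∣ ≡ suc m × All (_≢ v) F
superset-avoiding {n} W m ∣W∣≤m F ∣F∣+m<n
  with superset-of-size W m ∣W∣≤m (≤-trans (m≤n+m m (suc (length F))) ∣F∣+m<n)
... | Y , W⊆Y , ∣Y∣≡m with point-avoiding Y (∁ Y) x∈∁p⇒x∉p F ∣F∣<∣∁Y∣
  where
  ∣F∣<∣∁Y∣ : length F < ∣ ∁ Y ∣
  ∣F∣<∣∁Y∣ = subst (length F <_) (sym (trans (∣∁p∣≡n∸∣p∣ Y) (cong (n ∸_) ∣Y∣≡m)))
                   (m+n≤o⇒m≤o∸n (suc (length F)) ∣F∣+m<n)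
...   | z , z∈∁Y , avoids =
  Y ∪ ⁅ z ⁆ , (λ x∈W → p⊆p∪q ⁅ z ⁆ (W⊆Y x∈W)) , trans (∣p∪⁅x⁆∣≡1+∣p∣ Y (x∈∁p⇒x∉p z∈∁Y)) (cong suc ∣Y∣≡m) , avoids

-- A greedy transversal: a member of L contributes a new point only if it misses X and
-- the points chosen before it, so a transversal of full size forces every member to miss X.
record HittingSet {n : ℕ} (X : Subset n) (L : List (Subset n)) : Set where
  field
    set      : Subset n
    ⊇X       : X ⊆ set
    hits     : All (λ e → Meets e set) L
    size≤    : ∣ set ∣ ≤ ∣ X ∣ + length L
    tight⇒⊥X : ∣ X ∣ + length L ≤ ∣ set ∣ → All (λ e → Disjoint e X) L

hitting-set : (X : Subset n) (L : List (Subset n)) → All Nonempty L → HittingSet X L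
hitting-set X [] [] = record
  { set = X ; ⊇X = λ x∈X → x∈X ; hits = [] ; size≤ = ≤-reflexive (sym (+-identityʳ _)) ; tight⇒⊥X = λ _ → [] }
hitting-set X (e ∷ L) ((x , x∈e) ∷ nonempty) with disjoint? e X
... | no e∦X = record
  { set      = set
  ; ⊇X       = ⊇X
  ; hits     = Meets-⊆ʳ ⊇X (¬Disjoint⇒Meets e∦X) ∷ hits
  ; size≤    = ≤-trans size≤ (+-monoʳ-≤ ∣ X ∣ (n≤1+n _))
  ; tight⇒⊥X = λ tight → contradiction
      (≤-trans (≤-reflexive (sym (+-suc ∣ X ∣ (length L)))) (≤-trans tight size≤)) (n≮n _)
  }
  where open HittingSet (hitting-set X L nonempty)
... | yes e⊥X = record
  { set      = set
  ; ⊇X       = λ y∈X → ⊇X (p⊆p∪q ⁅ x ⁆ y∈X)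
  ; hits     = (x , x∈e , ⊇X (x∈p∪q⁺ (inj₂ (x∈⁅x⁆ x)))) ∷ hits
  ; size≤    = ≤-trans size≤ (≤-reflexive ∣X∪⁅x⁆∣+∣L∣)
  ; tight⇒⊥X = λ tight → e⊥X
      ∷ All.map (Disjoint-⊆ʳ (p⊆p∪q ⁅ x ⁆)) (tight⇒⊥X (≤-trans (≤-reflexive ∣X∪⁅x⁆∣+∣L∣) tight))
  }
  where
  open HittingSet (hitting-set (X ∪ ⁅ x ⁆) L nonempty)
  ∣X∪⁅x⁆∣+∣L∣ : ∣ X ∪ ⁅ x ⁆ ∣ + length L ≡ ∣ X ∣ + suc (length L)
  ∣X∪⁅x⁆∣+∣L∣ = trans (cong (_+ length L) (∣p∪⁅x⁆∣≡1+∣p∣ X λ x∈X → Disjoint⇒∉ˡ e⊥X x∈X x∈e))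
                      (sym (+-suc ∣ X ∣ (length L)))

≢∧Meets⇒∉N[v] : {v e : Subset n} → e ≢ v → Meets e v → ¬ InClosedNbhd v e
≢∧Meets⇒∉N[v] e≢v _    (inj₁ e≡v) = e≢v e≡v
≢∧Meets⇒∉N[v] _   e∦v (inj₂ e⊥v) = Meets⇒¬Disjoint e∦v e⊥v

Meets∧∈N[v]⇒≡ : {v e : Subset n} → Meets e v → InClosedNbhd v e → e ≡ v
Meets∧∈N[v]⇒≡ _    (inj₁ e≡v) = e≡v
Meets∧∈N[v]⇒≡ e∦v (inj₂ e⊥v) = contradiction e⊥v (Meets⇒¬Disjoint e∦v)

∉N[v]-all : {W v : Subset n} → W ⊆ v → {E : List (Subset n)}
       → All (_≢ v) E → All (λ e → Meets e W) E → All (λ e → ¬ InClosedNbhd v e) E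
∉N[v]-all W⊆v ≢v meetsW = All.zipWith (λ (e≢v , e∦W) → ≢∧Meets⇒∉N[v] e≢v (Meets-⊆ʳ W⊆v e∦W)) (≢v , meetsW)

nbhdCount-reject : {v e : Subset n} (E : List (Subset n)) → ¬ InClosedNbhd v e → nbhdCount v (e ∷ E) ≡ nbhdCount v E
nbhdCount-reject {v = v} _ e∉N = cong length (filter-reject (inClosedNbhd? v) e∉N)

nbhdCount-accept : {v e : Subset n} (E : List (Subset n)) → InClosedNbhd v e → nbhdCount v (e ∷ E) ≡ suc (nbhdCount v E)
nbhdCount-accept {v = v} _ e∈N = cong length (filter-accept (inClosedNbhd? v) e∈N)

nbhdCount-cons≤ : (v e : Subset n) (E : List (Subset n)) → nbhdCount v (e ∷ E) ≤ suc (nbhdCount v E)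
nbhdCount-cons≤ v e E with inClosedNbhd? v e
... | yes e∈N = ≤-reflexive (nbhdCount-accept E e∈N)
... | no e∉N  = ≤-trans (≤-reflexive (nbhdCount-reject E e∉N)) (n≤1+n _)

nbhdCount-none : {v : Subset n} (E : List (Subset n)) → All (λ e → ¬ InClosedNbhd v e) E → nbhdCount v E ≡ 0
nbhdCount-none {v = v} _ none = cong length (filter-none (inClosedNbhd? v) none)

nbhdCount-all-but-one : {v : Subset n} (E : List (Subset n)) {e : Subset n} {E′ : List (Subset n)}
                      → All (λ e → ¬ InClosedNbhd v e) (E ++ E′) → nbhdCount v (E ++ e ∷ E′) ≤ 1
nbhdCount-all-but-one {v = v} [] {e} {E′} none = ≤-trans (nbhdCount-cons≤ v e E′) (s≤s (≤-reflexive (nbhdCount-none E′ none)))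
nbhdCount-all-but-one (d ∷ E) {e} {E′} (d∉N ∷ none) =
  ≤-trans (≤-reflexive (nbhdCount-reject (E ++ e ∷ E′) d∉N)) (nbhdCount-all-but-one E none)

nbhdCount≤1 : {v : Subset n} (E : List (Subset n)) → Unique E → All (λ e → Meets e v) E → nbhdCount v E ≤ 1
nbhdCount≤1 [] _ _ = z≤n
nbhdCount≤1 {v = v} (e ∷ E) (e≢E ∷ unique) (e∦v ∷ E∦v) with inClosedNbhd? v e
... | yes e∈N = ≤-reflexive (trans (nbhdCount-accept E e∈N) (cong suc (nbhdCount-none E (∉N[v]-all (λ x∈v → x∈v) E≢v E∦v))))
  where
  E≢v : All (_≢ v) E
  E≢v = All.map (λ e≢d d≡v → e≢d (trans (Meets∧∈N[v]⇒≡ e∦v e∈N) (sym d≡v))) e≢E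
... | no e∉N  = ≤-trans (≤-reflexive (nbhdCount-reject E e∉N)) (nbhdCount≤1 E unique E∦v)

length-take≤ : {A : Set} (m : ℕ) (xs : List A) → length (take m xs) ≤ m
length-take≤ m xs = ≤-trans (≤-reflexive (length-take m xs)) (m⊓n≤m m (length xs))

nbhdCount-take : (v : Subset n) (m : ℕ) (E : List (Subset n)) {c : ℕ}
               → nbhdCount v (take m E) ≤ c → nbhdCount v E ≤ c + (length E ∸ m)
nbhdCount-take v m E {c} prefix≤c = begin
  nbhdCount v E                                          ≡⟨ cong (nbhdCount v) (sym (take++drop≡id m E)) ⟩
  nbhdCount v (take m E ++ drop m E)                     ≡⟨ cong length (filter-++ (inClosedNbhd? v) (take m E) (drop m E)) ⟩
  length (filter (inClosedNbhd? v) (take m E) ++ filter (inClosedNbhd? v) (drop m E))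
                                                         ≡⟨ length-++ (filter (inClosedNbhd? v) (take m E)) ⟩
  nbhdCount v (take m E) + nbhdCount v (drop m E)        ≤⟨ +-mono-≤ prefix≤c (length-filter (inClosedNbhd? v) (drop m E)) ⟩
  c + length (drop m E)                                  ≡⟨ cong (c +_) (length-drop m E) ⟩
  c + (length E ∸ m)                                     ∎
  where open ≤-Reasoning

nbhdCount-↭ : (v : Subset n) {E E′ : List (Subset n)} → E ↭ E′ → nbhdCount v E ≡ nbhdCount v E′
nbhdCount-↭ v E↭E′ = ↭-length (filter-↭ (inClosedNbhd? v) E↭E′)

IsKTupleDominating-↭ : {r k : ℕ} {D D′ : List (Subset n)} → D ↭ D′ → IsKTupleDominating n r k D → IsKTupleDominating n r k D′
IsKTupleDominating-↭ {n} D↭D′ (unique , vertices , dominates) =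
    ↭ₛ.Unique-resp-↭ (setoid (Subset n)) (↭⇒↭ₛ D↭D′) unique
  , All-resp-↭ D↭D′ vertices
  , λ v v-vertex → ≤-trans (dominates v v-vertex) (≤-reflexive (nbhdCount-↭ v D↭D′))

-- The lower bound

escaping-superset : (m : ℕ) (E : List (Subset n)) → length E + m < n → (W : Subset n) → ∣ W ∣ ≤ m
                  → All (λ e → Meets e W) E → Σ (Subset n) λ v → ∣ v ∣ ≡ suc m × All (λ e → ¬ InClosedNbhd v e) E
escaping-superset m E fits W ∣W∣≤m E∦W with superset-avoiding W m ∣W∣≤m E fits
... | v , W⊆v , ∣v∣≡1+m , E≢v = v , ∣v∣≡1+m , ∉N[v]-all W⊆v E≢v E∦W

escaping-extension : (X e : Subset n) (E : List (Subset n)) → Nonempty X → Disjoint e X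
                   → All (λ d → Meets d X) E → length E < ∣ e ∣
                   → Σ (Fin n) λ z → z ∉ X × All (λ d → ¬ InClosedNbhd (X ∪ ⁅ z ⁆) d) (e ∷ E)
escaping-extension X e E (y , y∈X) e⊥X E∦X ∣E∣<∣e∣ with point-avoiding X e (Disjoint⇒∉ʳ e⊥X) E ∣E∣<∣e∣
... | z , z∈e , E≢X∪⁅z⁆ =
  z , Disjoint⇒∉ʳ e⊥X z∈e , ≢∧Meets⇒∉N[v] e≢X∪⁅z⁆ (z , z∈e , x∈p∪q⁺ (inj₂ (x∈⁅x⁆ z))) ∷ ∉N[v]-all (p⊆p∪q ⁅ z ⁆) E≢X∪⁅z⁆ E∦X
  where
  e≢X∪⁅z⁆ : e ≢ X ∪ ⁅ z ⁆
  e≢X∪⁅z⁆ e≡X∪⁅z⁆ = Disjoint⇒∉ˡ e⊥X y∈X (subst (y ∈_) (sym e≡X∪⁅z⁆) (p⊆p∪q ⁅ z ⁆ y∈X))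

-- Let X be a transversal of the members after the first one, e, so |X| ≤ r − 1.  If e meets
-- X, or a point of e still fits, X extends to an r-set outside E: there are more ways to add
-- the last point than members.  Otherwise |X| = r − 1 and e misses X; then X plus a suitable
-- point of e is an r-set outside E, different from e because it contains X ≠ ∅.
escaping-vertex : (r : ℕ) → 2 ≤ r → r + r ≤ n → (E : List (Subset n)) → All (IsVertex n r) E → length E ≤ r
                → Σ (Subset n) λ v → IsVertex n r v × All (λ e → ¬ InClosedNbhd v e) E
escaping-vertex {n} (suc r′) (s≤s 1≤r′) 2r≤n = escape
  where
  Escaping : List (Subset n) → Set
  Escaping E = Σ (Subset n) λ v → IsVertex n (suc r′) v × All (λ e → ¬ InClosedNbhd v e) E

  fits : (E : List (Subset n)) → length E ≤ suc r′ → length E + r′ < n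
  fits E ∣E∣≤r = ≤-trans (s≤s (+-monoˡ-≤ r′ ∣E∣≤r)) (≤-trans (≤-reflexive (cong suc (sym (+-suc r′ r′)))) 2r≤n)

  escape : (E : List (Subset n)) → All (IsVertex n (suc r′)) E → length E ≤ suc r′ → Escaping E
  escape [] [] _ = escaping-superset r′ [] (fits [] z≤n) ⊥ (≤-trans (≤-reflexive (∣⊥∣≡0 n)) z≤n) []
  escape (e ∷ E) (∣e∣≡r ∷ vertices) (s≤s ∣E∣≤r′) = by-cases (disjoint? e X)
    where
    open HittingSet (hitting-set ⊥ E (All.map (∣p∣≡r⇒Nonempty (s≤s z≤n)) vertices)) renaming (set to X)

    ∣X∣≤r′ : ∣ X ∣ ≤ r′
    ∣X∣≤r′ = ≤-trans size≤ (≤-trans (≤-reflexive (cong (_+ length E) (∣⊥∣≡0 n))) ∣E∣≤r′)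

    through : (W : Subset n) → ∣ W ∣ ≤ r′ → All (λ d → Meets d W) (e ∷ E) → Escaping (e ∷ E)
    through = escaping-superset r′ (e ∷ E) (fits (e ∷ E) (s≤s ∣E∣≤r′))

    saturated : Disjoint e X → r′ ≤ ∣ X ∣ → Escaping (e ∷ E)
    saturated e⊥X r′≤∣X∣ =
      let z , z∉X , escapes = escaping-extension X e E X≢∅ e⊥X hits (subst (length E <_) (sym ∣e∣≡r) (s≤s ∣E∣≤r′))
      in X ∪ ⁅ z ⁆ , trans (∣p∪⁅x⁆∣≡1+∣p∣ X z∉X) (cong suc ∣X∣≡r′) , escapes
      where
      ∣X∣≡r′ : ∣ X ∣ ≡ r′
      ∣X∣≡r′ = ≤-antisym ∣X∣≤r′ r′≤∣X∣
      X≢∅ : Nonempty X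
      X≢∅ = 0<∣p∣⇒Nonempty X (≤-trans 1≤r′ r′≤∣X∣)

    by-cases : Dec (Disjoint e X) → Escaping (e ∷ E)
    by-cases (no e∦X) = through X ∣X∣≤r′ (¬Disjoint⇒Meets e∦X ∷ hits)
    by-cases (yes e⊥X) with ∣p∣≡r⇒Nonempty (s≤s z≤n) ∣e∣≡r | suc ∣ X ∣ ≤? r′
    ... | x , x∈e | yes room =
      through (X ∪ ⁅ x ⁆) (≤-trans (∣p∪⁅x⁆∣≤1+∣p∣ X x) room)
        ((x , x∈e , x∈p∪q⁺ (inj₂ (x∈⁅x⁆ x))) ∷ All.map (Meets-⊆ʳ (p⊆p∪q ⁅ x ⁆)) hits)
    ... | _ | no full = saturated e⊥X (≤-pred (≰⇒> full))

lower-bound : (r k : ℕ) → 2 ≤ r → 1 ≤ k → r + r ≤ n → (D : List (Subset n))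
            → IsKTupleDominating n r k D → k + r ≤ length D
lower-bound r k 2≤r 1≤k 2r≤n D (_ , vertices , dominates)
  with escaping-vertex r 2≤r 2r≤n (take r D) (All.take⁺ r vertices) (length-take≤ r D)
... | v , v-vertex , escapes = m≤o∸n⇒m+n≤o k r≤∣D∣ k≤∣D∣∸r
  where
  k≤∣D∣∸r : k ≤ length D ∸ r
  k≤∣D∣∸r = ≤-trans (dominates v v-vertex) (nbhdCount-take v r D (≤-reflexive (nbhdCount-none (take r D) escapes)))
  r≤∣D∣ : r ≤ length D
  r≤∣D∣ = <⇒≤ (m∸n≢0⇒n<m λ ∣D∣∸r≡0 → contradiction (≤-trans 1≤k (subst (k ≤_) ∣D∣∸r≡0 k≤∣D∣∸r)) λ ())

-- Pairwise disjoint families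

pairwise-disjoint-family : (r m : ℕ) → m * r ≤ n
                         → Σ (List (Subset n)) λ D → AllPairs Disjoint D × All (IsVertex n r) D × length D ≡ m
pairwise-disjoint-family r zero _ = [] , [] , [] , refl
pairwise-disjoint-family {n} r (suc m) [1+m]r≤n with pairwise-disjoint-family r m (m+n≤o⇒n≤o r [1+m]r≤n)
... | D , pairwise , vertices , ∣D∣≡m with subset-of-size (∁ (⋃ D)) r r≤∣∁⋃D∣
  where
  r≤∣∁⋃D∣ : r ≤ ∣ ∁ (⋃ D) ∣
  r≤∣∁⋃D∣ = subst (r ≤_)
    (sym (trans (∣∁p∣≡n∸∣p∣ (⋃ D)) (cong (n ∸_) (trans (∣⋃∣≡length*r D pairwise vertices) (cong (_* r) ∣D∣≡m)))))
    (m+n≤o⇒m≤o∸n r [1+m]r≤n)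
...   | e , e⊆∁⋃D , ∣e∣≡r = e ∷ D , Disjoint-⋃⁻ D e⊥⋃D ∷ pairwise , ∣e∣≡r ∷ vertices , cong suc ∣D∣≡m
  where
  e⊥⋃D : Disjoint e (⋃ D)
  e⊥⋃D = ¬Meets⇒Disjoint λ (x , x∈e , x∈⋃D) → x∈∁p⇒x∉p (e⊆∁⋃D x∈e) x∈⋃D

pairwise-disjoint⇒Unique : (D : List (Subset n)) → AllPairs Disjoint D → All Nonempty D → Unique D
pairwise-disjoint⇒Unique [] [] [] = []
pairwise-disjoint⇒Unique (d ∷ D) (d⊥D ∷ pairwise) ((x , x∈d) ∷ nonempty) =
  All.map (λ d⊥e d≡e → Disjoint⇒∉ʳ d⊥e x∈d (subst (x ∈_) d≡e x∈d)) d⊥D ∷ pairwise-disjoint⇒Unique D pairwise nonempty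

-- Each member outside N[v] meets v, and pairwise disjoint members meet v in disjoint parts.
length≤nbhdCount+∣∩⋃∣ : (v : Subset n) (D : List (Subset n)) → AllPairs Disjoint D
                      → length D ≤ nbhdCount v D + ∣ v ∩ ⋃ D ∣
length≤nbhdCount+∣∩⋃∣ v [] [] = z≤n
length≤nbhdCount+∣∩⋃∣ v (d ∷ D) (d⊥D ∷ pairwise) = by-cases (inClosedNbhd? v d)
  where
  open ≤-Reasoning
  IH : length D ≤ nbhdCount v D + ∣ v ∩ ⋃ D ∣
  IH = length≤nbhdCount+∣∩⋃∣ v D pairwise

  split : ∣ v ∩ ⋃ (d ∷ D) ∣ ≡ ∣ v ∩ d ∣ + ∣ v ∩ ⋃ D ∣
  split = trans (cong ∣_∣ (∩-distribˡ-∪ v d (⋃ D))) (∣p∪q∣≡∣p∣+∣q∣ (v ∩ d) (v ∩ ⋃ D) (¬Meets⇒Disjoint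
    λ (x , x∈v∩d , x∈v∩⋃D) → Meets⇒¬Disjoint (x , proj₂ (x∈p∩q⁻ v d x∈v∩d) , proj₂ (x∈p∩q⁻ v (⋃ D) x∈v∩⋃D))
                                              (Disjoint-⋃⁺ D d⊥D)))

  by-cases : Dec (InClosedNbhd v d) → length (d ∷ D) ≤ nbhdCount v (d ∷ D) + ∣ v ∩ ⋃ (d ∷ D) ∣
  by-cases (yes d∈N) = begin
    suc (length D)                                       ≤⟨ s≤s IH ⟩
    suc (nbhdCount v D + ∣ v ∩ ⋃ D ∣)                   ≤⟨ s≤s (+-monoʳ-≤ (nbhdCount v D) (m≤n+m _ ∣ v ∩ d ∣)) ⟩
    suc (nbhdCount v D) + (∣ v ∩ d ∣ + ∣ v ∩ ⋃ D ∣)     ≡⟨ cong₂ _+_ (sym (nbhdCount-accept D d∈N)) (sym split) ⟩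
    nbhdCount v (d ∷ D) + ∣ v ∩ ⋃ (d ∷ D) ∣             ∎
  by-cases (no d∉N) = begin
    suc (length D)                                       ≤⟨ s≤s IH ⟩
    suc (nbhdCount v D + ∣ v ∩ ⋃ D ∣)                   ≡⟨ sym (+-suc (nbhdCount v D) _) ⟩
    nbhdCount v D + suc ∣ v ∩ ⋃ D ∣                     ≤⟨ +-monoʳ-≤ (nbhdCount v D) (+-monoˡ-≤ ∣ v ∩ ⋃ D ∣ 1≤∣v∩d∣) ⟩
    nbhdCount v D + (∣ v ∩ d ∣ + ∣ v ∩ ⋃ D ∣)           ≡⟨ cong₂ _+_ (sym (nbhdCount-reject D d∉N)) (sym split) ⟩
    nbhdCount v (d ∷ D) + ∣ v ∩ ⋃ (d ∷ D) ∣             ∎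
    where
    1≤∣v∩d∣ : 1 ≤ ∣ v ∩ d ∣
    1≤∣v∩d∣ = let x , x∈d , x∈v = ¬Disjoint⇒Meets (λ d⊥v → d∉N (inj₂ d⊥v)) in x∈p⇒1≤∣p∣ (x∈p∩q⁺ (x∈v , x∈d))

pairwise-disjoint⇒dominating : (r k : ℕ) → 1 ≤ r → (D : List (Subset n)) → AllPairs Disjoint D
                             → All (IsVertex n r) D → length D ≡ k + r → IsKTupleDominating n r k D
pairwise-disjoint⇒dominating {n} r k (s≤s _) D pairwise vertices ∣D∣≡k+r =
  pairwise-disjoint⇒Unique D pairwise (All.map (∣p∣≡r⇒Nonempty (s≤s z≤n)) vertices) , vertices , dominates
  where
  dominates : (v : Subset n) → IsVertex n r v → k ≤ nbhdCount v D
  dominates v ∣v∣≡r = +-cancelʳ-≤ r k (nbhdCount v D) (begin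
    k + r                                 ≡⟨ sym ∣D∣≡k+r ⟩
    length D                              ≤⟨ length≤nbhdCount+∣∩⋃∣ v D pairwise ⟩
    nbhdCount v D + ∣ v ∩ ⋃ D ∣          ≤⟨ +-monoʳ-≤ (nbhdCount v D) (≤-trans (∣p∩q∣≤∣p∣ v (⋃ D)) (≤-reflexive ∣v∣≡r)) ⟩
    nbhdCount v D + r                     ∎)
    where open ≤-Reasoning

dominating-set-of-size : (r k : ℕ) → 1 ≤ r → r * (k + r) ≤ n
                       → Σ (List (Subset n)) λ D → IsKTupleDominating n r k D × length D ≡ k + r
dominating-set-of-size {n} r k 1≤r r[k+r]≤n
  with pairwise-disjoint-family r (k + r) (subst (_≤ n) (*-comm r (k + r)) r[k+r]≤n)
... | D , pairwise , vertices , ∣D∣≡k+r =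
  D , pairwise-disjoint⇒dominating r k 1≤r D pairwise vertices ∣D∣≡k+r , ∣D∣≡k+r

-- Dominating sets of size k + r are pairwise disjoint

meeting-partner : (d : Subset n) (D : List (Subset n))
                → All (Disjoint d) D ⊎ Σ (Subset n) λ a → Σ (List (Subset n)) λ rest → D ↭ a ∷ rest × Meets d a
meeting-partner d [] = inj₁ []
meeting-partner d (e ∷ D) with disjoint? d e
... | no d∦e = inj₂ (e , D , ↭-refl , ¬Disjoint⇒Meets d∦e)
... | yes d⊥e with meeting-partner d D
...   | inj₁ d⊥D = inj₁ (d⊥e ∷ d⊥D)
...   | inj₂ (a , rest , D↭a∷rest , d∦a) =
  inj₂ (a , e ∷ rest , ↭-trans (↭-prep e D↭a∷rest) (↭-swap e a ↭-refl) , d∦a)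

meeting-pair : (D : List (Subset n))
             → AllPairs Disjoint D ⊎ Σ (Subset n) λ a → Σ (Subset n) λ b → Σ (List (Subset n)) λ rest
                                       → D ↭ a ∷ b ∷ rest × Meets a b
meeting-pair [] = inj₁ []
meeting-pair (d ∷ D) with meeting-pair D
... | inj₂ (a , b , rest , D↭a∷b∷rest , a∦b) =
  inj₂ (a , b , d ∷ rest , ↭-trans (↭-prep d D↭a∷b∷rest) (↭-trans (↭-swap d a ↭-refl) (↭-prep a (↭-swap d b ↭-refl))) , a∦b)
... | inj₁ pairwise with meeting-partner d D
...   | inj₁ d⊥D = inj₁ (d⊥D ∷ pairwise)
...   | inj₂ (a , rest , D↭a∷rest , d∦a) = inj₂ (d , a , rest , ↭-prep d D↭a∷rest , d∦a)

-- Through x ∈ a ∩ b take a transversal Y of G, then of f and f′.  If this fits in r points,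
-- every member meets v ⊇ Y and only v itself can lie in N[v].  Otherwise |Y| = r − 1 and
-- f, f′ miss Y, so v = Y ∪ {z} with z ∈ f ∪ f′ (of size > r) can avoid a, b and G.
sparse-vertex : (r : ℕ) → r ≤ n → (a b f f′ : Subset n) (G : List (Subset n))
              → All (IsVertex n r) (a ∷ b ∷ f ∷ f′ ∷ G) → Unique (a ∷ b ∷ f ∷ f′ ∷ G) → length (a ∷ b ∷ G) ≤ r
              → Meets a b → Σ (Subset n) λ v → IsVertex n r v × nbhdCount v (a ∷ b ∷ f ∷ f′ ∷ G) ≤ 1
sparse-vertex {n} r r≤n a b f f′ G (_ ∷ _ ∷ ∣f∣≡r ∷ ∣f′∣≡r ∷ G-vertices) unique@(_ ∷ _ ∷ (f≢f′ ∷ _) ∷ _)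
              ∣abG∣≤r (x , x∈a , x∈b) = by-size (∣ Z ∣ ≤? r)
  where
  Sparse : Set
  Sparse = Σ (Subset n) λ v → IsVertex n r v × nbhdCount v (a ∷ b ∷ f ∷ f′ ∷ G) ≤ 1

  0<r : 0 < r
  0<r = ≤-trans (s≤s z≤n) ∣abG∣≤r

  open HittingSet (hitting-set ⁅ x ⁆ G (All.map (∣p∣≡r⇒Nonempty 0<r) G-vertices))
    using () renaming (set to Y; ⊇X to ⁅x⁆⊆Y; hits to G∦Y; size≤ to ∣Y∣≤1+∣G∣)
  open HittingSet (hitting-set Y (f ∷ f′ ∷ []) (∣p∣≡r⇒Nonempty 0<r ∣f∣≡r ∷ ∣p∣≡r⇒Nonempty 0<r ∣f′∣≡r ∷ []))
    using () renaming (set to Z; ⊇X to Y⊆Z; hits to ff′∦Z; size≤ to ∣Z∣≤∣Y∣+2; tight⇒⊥X to tight⇒ff′⊥Y)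

  x∈Y : x ∈ Y
  x∈Y = ⁅x⁆⊆Y (x∈⁅x⁆ x)

  1+∣Y∣≤r : suc ∣ Y ∣ ≤ r
  1+∣Y∣≤r = ≤-trans (s≤s (≤-trans ∣Y∣≤1+∣G∣ (≤-reflexive (cong (_+ length G) (∣⁅x⁆∣≡1 x))))) ∣abG∣≤r

  ∣Y∣+2≡2+∣Y∣ : ∣ Y ∣ + 2 ≡ suc (suc ∣ Y ∣)
  ∣Y∣+2≡2+∣Y∣ = +-comm ∣ Y ∣ 2

  saturated : suc r ≤ ∣ Z ∣ → Sparse
  saturated r<∣Z∣ = finish (point-avoiding Y (f ∪ f′) ff′∌Y (a ∷ b ∷ G) (≤-trans (s≤s ∣abG∣≤r) r<∣f∪f′∣))
    where
    1+∣Y∣≡r : suc ∣ Y ∣ ≡ r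
    1+∣Y∣≡r = ≤-antisym 1+∣Y∣≤r (≤-pred (≤-trans r<∣Z∣ (≤-trans ∣Z∣≤∣Y∣+2 (≤-reflexive ∣Y∣+2≡2+∣Y∣))))

    ff′⊥Y : All (λ e → Disjoint e Y) (f ∷ f′ ∷ [])
    ff′⊥Y = tight⇒ff′⊥Y (≤-trans (≤-reflexive (trans ∣Y∣+2≡2+∣Y∣ (cong suc 1+∣Y∣≡r))) r<∣Z∣)

    ff′∌Y : ∀ {z} → z ∈ f ∪ f′ → z ∉ Y
    ff′∌Y {z} z∈f∪f′ = [ Disjoint⇒∉ʳ (All.head ff′⊥Y) , Disjoint⇒∉ʳ (All.head (All.tail ff′⊥Y)) ]′ (x∈p∪q⁻ f f′ z∈f∪f′)

    r<∣f∪f′∣ : r < ∣ f ∪ f′ ∣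
    r<∣f∪f′∣ = subst (_< ∣ f ∪ f′ ∣) ∣f∣≡r (∣p∣<∣p∪q∣ f f′ (trans ∣f∣≡r (sym ∣f′∣≡r)) f≢f′)

    finish : (Σ (Fin n) λ z → z ∈ f ∪ f′ × All (_≢ Y ∪ ⁅ z ⁆) (a ∷ b ∷ G)) → Sparse
    finish (z , z∈f∪f′ , a≢v ∷ b≢v ∷ G≢v) =
      v , trans (∣p∪⁅x⁆∣≡1+∣p∣ Y (ff′∌Y z∈f∪f′)) 1+∣Y∣≡r , [ f-escapes , f′-escapes ]′ (x∈p∪q⁻ f f′ z∈f∪f′)
      where
      v : Subset n
      v = Y ∪ ⁅ z ⁆
      x∈v : x ∈ v
      x∈v = p⊆p∪q ⁅ z ⁆ x∈Y
      z∈v : z ∈ v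
      z∈v = x∈p∪q⁺ (inj₂ (x∈⁅x⁆ z))
      a∉N : ¬ InClosedNbhd v a
      a∉N = ≢∧Meets⇒∉N[v] a≢v (x , x∈a , x∈v)
      b∉N : ¬ InClosedNbhd v b
      b∉N = ≢∧Meets⇒∉N[v] b≢v (x , x∈b , x∈v)
      G∉N : All (λ e → ¬ InClosedNbhd v e) G
      G∉N = ∉N[v]-all (p⊆p∪q ⁅ z ⁆) G≢v G∦Y
      ⊥Y⇒≢v : {e : Subset n} → Disjoint e Y → e ≢ v
      ⊥Y⇒≢v e⊥Y e≡v = Disjoint⇒∉ˡ e⊥Y x∈Y (subst (x ∈_) (sym e≡v) x∈v)
      f-escapes : z ∈ f → nbhdCount v (a ∷ b ∷ f ∷ f′ ∷ G) ≤ 1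
      f-escapes z∈f = nbhdCount-all-but-one (a ∷ b ∷ f ∷ [])
        (a∉N ∷ b∉N ∷ ≢∧Meets⇒∉N[v] (⊥Y⇒≢v (All.head ff′⊥Y)) (z , z∈f , z∈v) ∷ G∉N)
      f′-escapes : z ∈ f′ → nbhdCount v (a ∷ b ∷ f ∷ f′ ∷ G) ≤ 1
      f′-escapes z∈f′ = nbhdCount-all-but-one (a ∷ b ∷ [])
        (a∉N ∷ b∉N ∷ ≢∧Meets⇒∉N[v] (⊥Y⇒≢v (All.head (All.tail ff′⊥Y))) (z , z∈f′ , z∈v) ∷ G∉N)

  by-size : Dec (∣ Z ∣ ≤ r) → Sparse
  by-size (no ∣Z∣≰r) = saturated (≰⇒> ∣Z∣≰r)
  by-size (yes ∣Z∣≤r) =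
    let v , Z⊆v , ∣v∣≡r = superset-of-size Z r ∣Z∣≤r r≤n
        x∈v = Z⊆v (Y⊆Z x∈Y)
    in v , ∣v∣≡r , nbhdCount≤1 (a ∷ b ∷ f ∷ f′ ∷ G) unique
         ( (x , x∈a , x∈v) ∷ (x , x∈b , x∈v)
         ∷ Meets-⊆ʳ Z⊆v (All.head ff′∦Z) ∷ Meets-⊆ʳ Z⊆v (All.head (All.tail ff′∦Z))
         ∷ All.map (Meets-⊆ʳ λ y∈Y → Z⊆v (Y⊆Z y∈Y)) G∦Y)

meeting-pair⇒¬dominating : (r k : ℕ) → 2 ≤ r → 2 ≤ k → r ≤ n → (a b : Subset n) (rest : List (Subset n))
                         → Meets a b → length (a ∷ b ∷ rest) ≡ k + r → ¬ IsKTupleDominating n r k (a ∷ b ∷ rest)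
meeting-pair⇒¬dominating (suc (suc t)) (suc (suc k′)) (s≤s (s≤s z≤n)) (s≤s (s≤s z≤n)) _ a b [] _ ∣D∣≡k+r _ =
  m+1+n≢0 k′ (sym (suc-injective (suc-injective ∣D∣≡k+r)))
meeting-pair⇒¬dominating (suc (suc t)) (suc (suc k′)) (s≤s (s≤s z≤n)) (s≤s (s≤s z≤n)) _ a b (f ∷ []) _ ∣D∣≡k+r _ =
  m+1+n≢0 k′ (sym (suc-injective (trans (suc-injective (suc-injective ∣D∣≡k+r)) (+-suc k′ (suc t)))))
meeting-pair⇒¬dominating r@(suc (suc t)) (suc (suc k′)) (s≤s (s≤s z≤n)) (s≤s (s≤s z≤n)) r≤n a b (f ∷ f′ ∷ rest) a∦b ∣D∣≡k+r
                         (unique , vertices , dominates)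
  -- take (2 + r) D reduces to a ∷ b ∷ f ∷ f′ ∷ take t rest
  with sparse-vertex r r≤n a b f f′ (take t rest) (All.take⁺ (2 + r) vertices) (Unique.take⁺ (2 + r) unique)
                     (s≤s (s≤s (length-take≤ t rest))) a∦b
... | v , ∣v∣≡r , sparse = n≮n (suc k′) (begin
  suc (suc k′)                                  ≤⟨ dominates v ∣v∣≡r ⟩
  nbhdCount v D                                 ≤⟨ nbhdCount-take v (2 + r) D sparse ⟩
  suc (length D ∸ (2 + r))                      ≡⟨ cong (λ l → suc (l ∸ (2 + r))) ∣D∣≡k+r ⟩
  suc (k′ + r ∸ r)                              ≡⟨ cong suc (m+n∸n≡m k′ r) ⟩
  suc k′                                        ∎)
  where
  open ≤-Reasoning
  D : List (Subset _)
  D = a ∷ b ∷ f ∷ f′ ∷ rest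

upper-bound : (r k : ℕ) → 2 ≤ r → 2 ≤ k → r ≤ n → (D : List (Subset n))
            → IsKTupleDominating n r k D → length D ≡ k + r → r * (k + r) ≤ n
upper-bound {n} r k 2≤r 2≤k r≤n D dominating@(_ , vertices , _) ∣D∣≡k+r with meeting-pair D
... | inj₁ pairwise = begin
  r * (k + r)     ≡⟨ *-comm r (k + r) ⟩
  (k + r) * r     ≡⟨ cong (_* r) (sym ∣D∣≡k+r) ⟩
  length D * r    ≡⟨ sym (∣⋃∣≡length*r D pairwise vertices) ⟩
  ∣ ⋃ D ∣         ≤⟨ ∣p∣≤n (⋃ D) ⟩
  n               ∎
  where open ≤-Reasoning
... | inj₂ (a , b , rest , D↭a∷b∷rest , a∦b) = ⊥-elim
  (meeting-pair⇒¬dominating r k 2≤r 2≤k r≤n a b rest a∦b (trans (sym (↭-length D↭a∷b∷rest)) ∣D∣≡k+r)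
                            (IsKTupleDominating-↭ D↭a∷b∷rest dominating))

-- The hypothesis k ≤ 1 + C(n − r, r) only says that γ_{×k} is defined.
theorem11 : (n r k : ℕ) → 2 ≤ r → suc (2 * r) ≤ n → 2 ≤ k
    → k ≤ suc ((n ∸ r) C r)
    → (GammaTimesIs n r k (k + r) → r * (k + r) ≤ n)
    × (r * (k + r) ≤ n → GammaTimesIs n r k (k + r))
theorem11 n r k 2≤r 2r<n 2≤k _ =
    (λ ((D , dominating , ∣D∣≡k+r) , _) → upper-bound r k 2≤r 2≤k r≤n D dominating ∣D∣≡k+r)
  , λ r[k+r]≤n → dominating-set-of-size r k 1≤r r[k+r]≤n , λ D dominating → lower-bound r k 2≤r 1≤k 2r≤n D dominating
  where
  2r≤n : r + r ≤ n
  2r≤n = ≤-trans (≤-reflexive (cong (r +_) (sym (+-identityʳ r)))) (≤-trans (n≤1+n _) 2r<n)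
  r≤n : r ≤ n
  r≤n = ≤-trans (m≤m+n r r) 2r≤n
  1≤r : 1 ≤ r
  1≤r = ≤-trans (s≤s z≤n) 2≤r
  1≤k : 1 ≤ k
  1≤k = ≤-trans (s≤s z≤n) 2≤k
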